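{- Let $G$ be a simple graph on $n$ vertices with adjacency matrix $A$ and walk-matrix $W=[e,Ae,\dots,A^{n-1}e]$ ($e$ the all-one vector), and assume $\det(W)\neq0$. Let $Q$ be a rational orthogonal matrix with $Qe=e$ such that $Q^TAQ$ is a symmetric $(0,1)$-matrix with zero diagonal, and suppose the level of $Q$ equals $2$. Then there exists a $(0,1)$-vector $u$ with exactly four entries equal to $1$ such that $$u^TA^ku\equiv 0\pmod 4,\quad k=1,2,\dots,n-1,$$ and moreover $W^Tu\equiv 0\pmod 2$ and $u\not\equiv 0\pmod 2$.
   Context: The level of a rational matrix $Q$ is the smallest positive integer $\ell$ such that $\ell Q$ is integral. Congruences of vectors are entrywise. -}

module Defs where

open import Data.Nat as ℕ using (ℕ; zero; suc; _<_)
open import Data.Fin using (Fin; zero; suc; punchIn; toℕ)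
open import Data.Integer as ℤ using (ℤ; +_)
open import Data.Integer.Divisibility as ℤD using ()
open import Data.Rational as ℚ using (ℚ)
open import Data.Product using (Σ; _×_; ∃)
open import Data.Sum using (_⊎_)
open import Relation.Binary.PropositionalEquality using (_≡_)
open import Relation.Nullary using (¬_)

Mat : Set → ℕ → ℕ → Set
Mat A m n = Fin m → Fin n → A

Vect : Set → ℕ → Set
Vect A n = Fin n → A

module MatOps {A : Set} (0# 1# : A) (_+_ _*_ : A → A → A) where

  Σ[<_] : ∀ n → (Fin n → A) → A
  Σ[< zero ] f = 0#
  Σ[< suc n ] f = f zero + Σ[< n ] (λ i → f (suc i))

  _·_ : ∀ {m k n} → Mat A m k → Mat A k n → Mat A m n
  _·_ {k = k} M N i j = Σ[< k ] (λ l → M i l * N l j)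

  _ᵀ : ∀ {m n} → Mat A m n → Mat A n m
  (M ᵀ) i j = M j i

  I : ∀ {n} → Mat A n n
  I zero zero = 1#
  I zero (suc j) = 0#
  I (suc i) zero = 0#
  I (suc i) (suc j) = I i j

  _^_ : ∀ {n} → Mat A n n → ℕ → Mat A n n
  M ^ zero = I
  M ^ suc k = M · (M ^ k)

  _⊙_ : ∀ {m n} → Mat A m n → Vect A n → Vect A m
  _⊙_ {n = n} M v i = Σ[< n ] (λ j → M i j * v j)

  dot : ∀ {n} → Vect A n → Vect A n → A
  dot {n} v w = Σ[< n ] (λ i → v i * w i)

  e : ∀ {n} → Vect A n
  e _ = 1#

module Zm = MatOps (+ 0) (+ 1) ℤ._+_ ℤ._*_
module Qm = MatOps (ℚ.0ℚ) (ℚ.1ℚ) ℚ._+_ ℚ._*_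

det : ∀ n → Mat ℤ n n → ℤ
det zero M = + 1
det (suc n) M = Zm.Σ[< suc n ] (λ j →
  sign (toℕ j) ℤ.* (M zero j ℤ.* det n (λ i k → M (suc i) (punchIn j k))))
  where
  sign : ℕ → ℤ
  sign zero = + 1
  sign (suc k) = ℤ.- sign k

IsAdjacency : ∀ {n} → Mat ℤ n n → Set
IsAdjacency {n} A =
  (∀ i j → (A i j ≡ + 0) ⊎ (A i j ≡ + 1)) ×
  (∀ i j → A i j ≡ A j i) ×
  (∀ i → A i i ≡ + 0)

IsAdjacencyℚ : ∀ {n} → Mat ℚ n n → Set
IsAdjacencyℚ {n} B =
  (∀ i j → (B i j ≡ ℚ.0ℚ) ⊎ (B i j ≡ ℚ.1ℚ)) ×
  (∀ i j → B i j ≡ B j i) ×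
  (∀ i → B i i ≡ ℚ.0ℚ)

walkMatrix : ∀ {n} → Mat ℤ n n → Mat ℤ n n
walkMatrix A i k = Zm._⊙_ (Zm._^_ A (toℕ k)) Zm.e i

toℚMat : ∀ {m n} → Mat ℤ m n → Mat ℚ m n
toℚMat M i j = (M i j) ℚ./ 1

IsOrthogonal : ∀ {n} → Mat ℚ n n → Set
IsOrthogonal Q = ∀ i j → Qm._·_ (Qm._ᵀ Q) Q i j ≡ Qm.I i j

IsIntegralℚ : ℚ → Set
IsIntegralℚ q = ℚ.denominatorℕ q ≡ 1

IsIntegralMat : ∀ {m n} → Mat ℚ m n → Set
IsIntegralMat M = ∀ i j → IsIntegralℚ (M i j)

scaleMat : ∀ {m n} → ℕ → Mat ℚ m n → Mat ℚ m n
scaleMat l M i j = ((+ l) ℚ./ 1) ℚ.* M i j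

IsLevel : ∀ {m n} → Mat ℚ m n → ℕ → Set
IsLevel Q l =
  (0 < l) × IsIntegralMat (scaleMat l Q) ×
  (∀ m → 0 < m → IsIntegralMat (scaleMat m Q) → l ℕ.≤ m)

_≡_[mod_] : ℤ → ℤ → ℕ → Set
x ≡ y [mod d ] = (+ d) ℤD.∣ (x ℤ.- y)

module Submission where

-- Let  M = 2Q ; since Q has level 2, M is an integer
-- matrix which is not entrywise even.  Orthogonality and  Qe = e  give
-- Mᵀ M = 4I  and  Me = 2e , and the hypothesis on  B = Qᵀ A Q  gives
-- Mᵀ A M = 4C  with C integral.  A trace computation shows  M Mᵀ = 4I  as
-- well, hence  A M = M C ,  Aᵏ M = M Cᵏ  and  Mᵀ e = 2e .  Choose a column x
-- of M with an odd entry and let u be its parity vector, so  x = u + 2y .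
-- Since  xᵀ x = 4 , exactly four entries of x are odd; since
-- xᵀ Aᵏ x = 4 (Cᵏ)ⱼⱼ  and  (Aᵏ e)ᵀ x = 2 eᵀ Cᵏ eⱼ , reducing modulo 2 gives
-- uᵀ Aᵏ u ≡ 0 (mod 4)  and  Wᵀ u ≡ 0 (mod 2) .

open import Defs
open import Data.Nat using (ℕ; _<_; _≤_)
open import Data.Fin using (Fin; toℕ)
open import Data.Integer using (ℤ; +_)
open import Data.Rational using (ℚ)
open import Data.Product using (Σ; _×_; ∃)
open import Data.Sum using (_⊎_)
open import Relation.Binary.PropositionalEquality using (_≡_; _≢_)
open import Relation.Nullary using (¬_)

open import Data.Nat using (zero; suc)
import Data.Nat as ℕ
import Data.Nat.Properties as ℕP
open import Data.Nat.DivMod using (_%_; _/_; m≡m%n+[m/n]*n; m%n<n)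
import Data.Nat.Divisibility as ℕD
import Data.Nat.Tactic.RingSolver as ℕSolver
open import Data.Fin using (zero; suc)
import Data.Fin.Properties as FinP
open import Data.Integer using (-[1+_])
import Data.Integer as ℤ
import Data.Integer.Properties as ℤP
import Data.Integer.GCD as ℤGCD
open import Data.Integer.Tactic.RingSolver using (solve-∀)
open import Data.Rational using (↥_; ↧_)
import Data.Rational as ℚ
import Data.Rational.Properties as ℚP
import Data.Rational.Unnormalised as ℚᵘ
import Data.Rational.Unnormalised.Properties as ℚᵘP
open import Data.Product using (∃-syntax; _,_; proj₁; proj₂)
open import Data.Sum using (inj₁; inj₂)
import Data.Sum
open import Data.Empty using (⊥-elim)
open import Algebra.Structures using (IsCommutativeSemigroup; IsCommutativeSemiring; IsCommutativeRing)
open import Algebra.Bundles using (CommutativeSemigroup)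
import Algebra.Properties.CommutativeSemigroup as CommutativeSemigroupProperties
open import Relation.Binary.Bundles using (Setoid)
open import Relation.Binary.PropositionalEquality
  using (refl; sym; trans; cong; cong₂; subst; module ≡-Reasoning)
import Relation.Binary.Reasoning.Setoid as SetoidReasoning

module MatrixAlgebra {R : Set} {zero# one# : R} {plus times : R → R → R}
  (isCS : IsCommutativeSemiring _≡_ plus times zero# one#) where

  infixl 6 _+_
  infixl 7 _*_
  _+_ _*_ : R → R → R
  _+_ = plus
  _*_ = times

  open MatOps zero# one# _+_ _*_ public
  open IsCommutativeSemiring isCS hiding (refl; sym; trans; zero)

  private
    semigroup : ∀ {_∙_ : R → R → R} → IsCommutativeSemigroup _≡_ _∙_ → CommutativeSemigroup _ _
    semigroup {_∙_} isCSg =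
      record { Carrier = R ; _≈_ = _≡_ ; _∙_ = _∙_ ; isCommutativeSemigroup = isCSg }

  open CommutativeSemigroupProperties (semigroup +-isCommutativeSemigroup)
    using () renaming (interchange to +-interchange)
  open CommutativeSemigroupProperties (semigroup *-isCommutativeSemigroup)
    using (x∙yz≈y∙xz; x∙yz≈y∙zx; x∙yz≈z∙yx)

  Σ-cong : ∀ n {f g : Fin n → R} → (∀ i → f i ≡ g i) → Σ[< n ] f ≡ Σ[< n ] g
  Σ-cong zero    f≗g = refl
  Σ-cong (suc n) f≗g = cong₂ _+_ (f≗g zero) (Σ-cong n (λ i → f≗g (suc i)))

  Σ-0 : ∀ n → Σ[< n ] (λ _ → zero#) ≡ zero#
  Σ-0 zero    = refl
  Σ-0 (suc n) = trans (cong (_+_ zero#) (Σ-0 n)) (+-identityˡ zero#)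

  Σ-+ : ∀ n (f g : Fin n → R) → Σ[< n ] (λ i → f i + g i) ≡ Σ[< n ] f + Σ[< n ] g
  Σ-+ zero    f g = sym (+-identityˡ zero#)
  Σ-+ (suc n) f g =
    trans (cong (_+_ (f zero + g zero)) (Σ-+ n (λ i → f (suc i)) (λ i → g (suc i))))
          (+-interchange (f zero) (g zero) _ _)

  Σ-*ˡ : ∀ n c (f : Fin n → R) → Σ[< n ] (λ i → c * f i) ≡ c * Σ[< n ] f
  Σ-*ˡ zero    c f = sym (zeroʳ c)
  Σ-*ˡ (suc n) c f =
    trans (cong (_+_ (c * f zero)) (Σ-*ˡ n c (λ i → f (suc i)))) (sym (distribˡ c _ _))

  Σ-swap : ∀ m n (f : Fin m → Fin n → R) →
    Σ[< m ] (λ i → Σ[< n ] (f i)) ≡ Σ[< n ] (λ j → Σ[< m ] (λ i → f i j))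
  Σ-swap zero    n f = sym (Σ-0 n)
  Σ-swap (suc m) n f =
    trans (cong (_+_ (Σ[< n ] (f zero))) (Σ-swap m n (λ i → f (suc i)))) (sym (Σ-+ n _ _))

  ΣΣ : ∀ m n → (Fin m → Fin n → R) → R
  ΣΣ m n f = Σ[< m ] (λ i → Σ[< n ] (f i))

  ΣΣ-+ : ∀ m n (f g : Fin m → Fin n → R) →
    ΣΣ m n (λ i j → f i j + g i j) ≡ ΣΣ m n f + ΣΣ m n g
  ΣΣ-+ m n f g = trans (Σ-cong m (λ i → Σ-+ n (f i) (g i))) (Σ-+ m _ _)

  ΣΣ-*ˡ : ∀ m n c (f : Fin m → Fin n → R) → ΣΣ m n (λ i j → c * f i j) ≡ c * ΣΣ m n f
  ΣΣ-*ˡ m n c f = trans (Σ-cong m (λ i → Σ-*ˡ n c (f i))) (Σ-*ˡ m c _)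

  I-diag : ∀ {n} (i : Fin n) → I i i ≡ one#
  I-diag zero    = refl
  I-diag (suc i) = I-diag i

  I-sym : ∀ {n} (i j : Fin n) → I i j ≡ I j i
  I-sym zero    zero    = refl
  I-sym zero    (suc j) = refl
  I-sym (suc i) zero    = refl
  I-sym (suc i) (suc j) = I-sym i j

  Σ-select : ∀ n (f : Fin n → R) i → Σ[< n ] (λ j → I i j * f j) ≡ f i
  Σ-select (suc n) f zero = begin
    one# * f zero + Σ[< n ] (λ j → zero# * f (suc j))
      ≡⟨ cong₂ _+_ (*-identityˡ (f zero)) (Σ-cong n (λ j → zeroˡ (f (suc j)))) ⟩
    f zero + Σ[< n ] (λ _ → zero#)  ≡⟨ cong (_+_ (f zero)) (Σ-0 n) ⟩
    f zero + zero#                  ≡⟨ +-identityʳ (f zero) ⟩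
    f zero                          ∎
    where open ≡-Reasoning
  Σ-select (suc n) f (suc i) =
    trans (cong₂ _+_ (zeroˡ (f zero)) (Σ-select n (λ j → f (suc j)) i)) (+-identityˡ (f (suc i)))

  infix 4 _≋_
  _≋_ : ∀ {m n} → Mat R m n → Mat R m n → Set
  X ≋ Y = ∀ i j → X i j ≡ Y i j

  ≋-setoid : ℕ → ℕ → Setoid _ _
  ≋-setoid m n = record
    { Carrier = Mat R m n
    ; _≈_ = _≋_
    ; isEquivalence = record
      { refl = λ _ _ → refl
      ; sym = λ p i j → sym (p i j)
      ; trans = λ p q i j → trans (p i j) (q i j)
      }
    }

  module ≋-Reasoning {m n : ℕ} = SetoidReasoning (≋-setoid m n)

  infixr 7 _∙_
  _∙_ : ∀ {m n} → R → Mat R m n → Mat R m n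
  (c ∙ X) i j = c * X i j

  ·-cong : ∀ {m k n} {X X′ : Mat R m k} {Y Y′ : Mat R k n} →
    X ≋ X′ → Y ≋ Y′ → X · Y ≋ X′ · Y′
  ·-cong {k = k} X≋X′ Y≋Y′ i j = Σ-cong k (λ l → cong₂ _*_ (X≋X′ i l) (Y≋Y′ l j))

  ·-congˡ : ∀ {m k n} {X X′ : Mat R m k} (Y : Mat R k n) → X ≋ X′ → X · Y ≋ X′ · Y
  ·-congˡ Y X≋X′ = ·-cong X≋X′ (λ _ _ → refl)

  ·-congʳ : ∀ {m k n} (X : Mat R m k) {Y Y′ : Mat R k n} → Y ≋ Y′ → X · Y ≋ X · Y′
  ·-congʳ X = ·-cong (λ _ _ → refl)

  ·-assoc : ∀ {m k l n} (X : Mat R m k) (Y : Mat R k l) (Z : Mat R l n) →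
    (X · Y) · Z ≋ X · (Y · Z)
  ·-assoc {k = k} {l} X Y Z i j = begin
    Σ[< l ] (λ b → Σ[< k ] (λ a → X i a * Y a b) * Z b j)
      ≡⟨ Σ-cong l (λ b → trans (*-comm _ (Z b j)) (sym (Σ-*ˡ k (Z b j) _))) ⟩
    Σ[< l ] (λ b → Σ[< k ] (λ a → Z b j * (X i a * Y a b)))
      ≡⟨ Σ-swap l k _ ⟩
    Σ[< k ] (λ a → Σ[< l ] (λ b → Z b j * (X i a * Y a b)))
      ≡⟨ Σ-cong k (λ a → trans (Σ-cong l (λ b → x∙yz≈y∙zx (Z b j) (X i a) (Y a b)))
                                (Σ-*ˡ l (X i a) _)) ⟩
    Σ[< k ] (λ a → X i a * Σ[< l ] (λ b → Y a b * Z b j)) ∎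
    where open ≡-Reasoning

  ·-identityˡ : ∀ {m n} (X : Mat R m n) → I · X ≋ X
  ·-identityˡ {m} X i j = Σ-select m (λ l → X l j) i

  ·-identityʳ : ∀ {m n} (X : Mat R m n) → X · I ≋ X
  ·-identityʳ {n = n} X i j = begin
    Σ[< n ] (λ l → X i l * I l j)  ≡⟨ Σ-cong n (λ l → trans (*-comm _ _) (cong (_* X i l) (I-sym l j))) ⟩
    Σ[< n ] (λ l → I j l * X i l)  ≡⟨ Σ-select n (X i) j ⟩
    X i j                          ∎
    where open ≡-Reasoning

  ᵀ-· : ∀ {m k n} (X : Mat R m k) (Y : Mat R k n) → (X · Y) ᵀ ≋ (Y ᵀ) · (X ᵀ)
  ᵀ-· {k = k} X Y i j = Σ-cong k (λ l → *-comm (X j l) (Y l i))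

  ·-∙ˡ : ∀ {m k n} c (X : Mat R m k) (Y : Mat R k n) → (c ∙ X) · Y ≋ c ∙ (X · Y)
  ·-∙ˡ {k = k} c X Y i j = trans (Σ-cong k (λ l → *-assoc c (X i l) (Y l j))) (Σ-*ˡ k c _)

  ·-∙ʳ : ∀ {m k n} c (X : Mat R m k) (Y : Mat R k n) → X · (c ∙ Y) ≋ c ∙ (X · Y)
  ·-∙ʳ {k = k} c X Y i j = trans (Σ-cong k (λ l → x∙yz≈y∙xz (X i l) c (Y l j))) (Σ-*ˡ k c _)

  ·-∙∙ : ∀ {m k n} a b (X : Mat R m k) (Y : Mat R k n) → (a ∙ X) · (b ∙ Y) ≋ (a * b) ∙ (X · Y)
  ·-∙∙ a b X Y i j = begin
    ((a ∙ X) · (b ∙ Y)) i j  ≡⟨ ·-∙ˡ a X (b ∙ Y) i j ⟩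
    a * (X · (b ∙ Y)) i j    ≡⟨ cong (a *_) (·-∙ʳ b X Y i j) ⟩
    a * (b * (X · Y) i j)    ≡⟨ sym (*-assoc a b _) ⟩
    (a * b) * (X · Y) i j    ∎
    where open ≡-Reasoning

  ^-intertwine : ∀ {m n} (X : Mat R m m) (M : Mat R m n) (Y : Mat R n n) →
    X · M ≋ M · Y → ∀ k → (X ^ k) · M ≋ M · (Y ^ k)
  ^-intertwine X M Y XM≋MY zero = begin
    I · M  ≈⟨ ·-identityˡ M ⟩
    M      ≈⟨ ·-identityʳ M ⟨
    M · I  ∎
    where open ≋-Reasoning
  ^-intertwine X M Y XM≋MY (suc k) = begin
    (X · (X ^ k)) · M  ≈⟨ ·-assoc X (X ^ k) M ⟩
    X · ((X ^ k) · M)  ≈⟨ ·-congʳ X (^-intertwine X M Y XM≋MY k) ⟩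
    X · (M · (Y ^ k))  ≈⟨ ·-assoc X M (Y ^ k) ⟨
    (X · M) · (Y ^ k)  ≈⟨ ·-congˡ (Y ^ k) XM≋MY ⟩
    (M · Y) · (Y ^ k)  ≈⟨ ·-assoc M Y (Y ^ k) ⟩
    M · (Y · (Y ^ k))  ∎
    where open ≋-Reasoning

  ^-sym : ∀ {n} (X : Mat R n n) → X ᵀ ≋ X → ∀ k → (X ^ k) ᵀ ≋ X ^ k
  ^-sym X Xᵀ≋X zero    i j = I-sym j i
  ^-sym X Xᵀ≋X (suc k) = begin
    (X · (X ^ k)) ᵀ      ≈⟨ ᵀ-· X (X ^ k) ⟩
    ((X ^ k) ᵀ) · (X ᵀ)  ≈⟨ ·-cong (^-sym X Xᵀ≋X k) Xᵀ≋X ⟩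
    (X ^ k) · X          ≈⟨ ^-intertwine X X X (λ _ _ → refl) k ⟩
    X · (X ^ k)          ∎
    where open ≋-Reasoning

  tr : ∀ {n} → Mat R n n → R
  tr {n} X = Σ[< n ] (λ i → X i i)

  tr-cong : ∀ {n} {X Y : Mat R n n} → X ≋ Y → tr X ≡ tr Y
  tr-cong {n} X≋Y = Σ-cong n (λ i → X≋Y i i)

  tr-comm : ∀ {m n} (X : Mat R m n) (Y : Mat R n m) → tr (X · Y) ≡ tr (Y · X)
  tr-comm {m} {n} X Y =
    trans (Σ-swap m n _) (Σ-cong n (λ j → Σ-cong m (λ i → *-comm (X i j) (Y j i))))

  tr-∙ : ∀ {n} c (X : Mat R n n) → tr (c ∙ X) ≡ c * tr X
  tr-∙ {n} c X = Σ-*ˡ n c _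

  -- Vectors.  Note that  (N ⊙ v) i  is  dot (N i) v , and is the entry
  -- (i , 0) of the product of N with the column matrix of v.

  col : ∀ {n} → Vect R n → Mat R n 1
  col v i _ = v i

  ⊙-· : ∀ {m k n} (X : Mat R m k) (Y : Mat R k n) (v : Vect R n) i →
    ((X · Y) ⊙ v) i ≡ (X ⊙ (Y ⊙ v)) i
  ⊙-· X Y v i = ·-assoc X Y (col v) i zero

  dot-comm : ∀ {n} (v w : Vect R n) → dot v w ≡ dot w v
  dot-comm {n} v w = Σ-cong n (λ i → *-comm (v i) (w i))

  dot-linearʳ : ∀ {n} (z v w : Vect R n) c →
    dot z (λ i → v i + c * w i) ≡ dot z v + c * dot z w
  dot-linearʳ {n} z v w c = begin
    Σ[< n ] (λ i → z i * (v i + c * w i))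
      ≡⟨ Σ-cong n (λ i → trans (distribˡ (z i) (v i) (c * w i)) (cong (_+_ (z i * v i)) (x∙yz≈y∙xz (z i) c (w i)))) ⟩
    Σ[< n ] (λ i → z i * v i + c * (z i * w i))
      ≡⟨ Σ-+ n _ _ ⟩
    dot z v + Σ[< n ] (λ i → c * (z i * w i))
      ≡⟨ cong (_+_ (dot z v)) (Σ-*ˡ n c _) ⟩
    dot z v + c * dot z w ∎
    where open ≡-Reasoning

  dot-linearˡ : ∀ {n} (v w z : Vect R n) c →
    dot (λ i → v i + c * w i) z ≡ dot v z + c * dot w z
  dot-linearˡ v w z c = begin
    dot (λ i → v i + c * w i) z  ≡⟨ dot-comm _ z ⟩
    dot z (λ i → v i + c * w i)  ≡⟨ dot-linearʳ z v w c ⟩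
    dot z v + c * dot z w        ≡⟨ cong₂ (λ a b → a + c * b) (dot-comm z v) (dot-comm z w) ⟩
    dot v z + c * dot w z        ∎
    where open ≡-Reasoning

  dot-adjoint : ∀ {n} (N : Mat R n n) (v w : Vect R n) → dot v (N ⊙ w) ≡ dot ((N ᵀ) ⊙ v) w
  dot-adjoint {n} N v w = begin
    Σ[< n ] (λ i → v i * Σ[< n ] (λ j → N i j * w j))
      ≡⟨ Σ-cong n (λ i → sym (Σ-*ˡ n (v i) _)) ⟩
    Σ[< n ] (λ i → Σ[< n ] (λ j → v i * (N i j * w j)))
      ≡⟨ Σ-swap n n _ ⟩
    Σ[< n ] (λ j → Σ[< n ] (λ i → v i * (N i j * w j)))
      ≡⟨ Σ-cong n (λ j → trans (Σ-cong n (λ i → x∙yz≈z∙yx (v i) (N i j) (w j))) (Σ-*ˡ n (w j) _)) ⟩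
    Σ[< n ] (λ j → w j * Σ[< n ] (λ i → N i j * v i))
      ≡⟨ dot-comm w _ ⟩
    dot ((N ᵀ) ⊙ v) w ∎
    where open ≡-Reasoning

  dot-sym : ∀ {n} (N : Mat R n n) → N ᵀ ≋ N → ∀ (v w : Vect R n) →
    dot w (N ⊙ v) ≡ dot v (N ⊙ w)
  dot-sym {n} N Nᵀ≋N v w = begin
    dot w (N ⊙ v)         ≡⟨ dot-adjoint N w v ⟩
    dot ((N ᵀ) ⊙ w) v     ≡⟨ Σ-cong n (λ i → cong (_* v i) (Σ-cong n (λ j → cong (_* w j) (Nᵀ≋N i j)))) ⟩
    dot (N ⊙ w) v         ≡⟨ dot-comm (N ⊙ w) v ⟩
    dot v (N ⊙ w)         ∎
    where open ≡-Reasoning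

  quadratic-expansion : ∀ {n} (N : Mat R n n) → N ᵀ ≋ N → ∀ (x v w : Vect R n) c →
    (∀ i → x i ≡ v i + c * w i) →
    let b = dot v (N ⊙ w)
    in dot x (N ⊙ x) ≡ (dot v (N ⊙ v) + c * b) + c * (b + c * dot w (N ⊙ w))
  quadratic-expansion {n} N Nᵀ≋N x v w c x≡v+cw = begin
    dot x (N ⊙ x)
      ≡⟨ Σ-cong n (λ i → cong₂ _*_ (x≡v+cw i) (Nx≡ i)) ⟩
    dot (λ i → v i + c * w i) Nx
      ≡⟨ dot-linearˡ v w Nx c ⟩
    dot v Nx + c * dot w Nx
      ≡⟨ cong₂ (λ a b → a + c * b) (dot-linearʳ v (N ⊙ v) (N ⊙ w) c) (dot-linearʳ w (N ⊙ v) (N ⊙ w) c) ⟩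
    (dot v (N ⊙ v) + c * b) + c * (dot w (N ⊙ v) + c * dot w (N ⊙ w))
      ≡⟨ cong (λ a → (dot v (N ⊙ v) + c * b) + c * (a + c * dot w (N ⊙ w))) (dot-sym N Nᵀ≋N v w) ⟩
    (dot v (N ⊙ v) + c * b) + c * (b + c * dot w (N ⊙ w)) ∎
    where
    open ≡-Reasoning
    Nx : Vect R n
    Nx i = (N ⊙ v) i + c * (N ⊙ w) i
    Nx≡ : ∀ i → (N ⊙ x) i ≡ Nx i
    Nx≡ i = trans (Σ-cong n (λ j → cong (N i j *_) (x≡v+cw j))) (dot-linearʳ (N i) v w c)
    b : R
    b = dot v (N ⊙ w)

  conjugation-intertwines : ∀ {n} (A M C : Mat R n n) c → M · (M ᵀ) ≋ c ∙ I →
    ((M ᵀ) · A) · M ≋ c ∙ C → c ∙ (A · M) ≋ c ∙ (M · C)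
  conjugation-intertwines A M C c MMᵀ≋cI MᵀAM≋cC = begin
    c ∙ (A · M)            ≈⟨ (λ i j → cong (c *_) (·-identityˡ (A · M) i j)) ⟨
    c ∙ (I · (A · M))      ≈⟨ ·-∙ˡ c I (A · M) ⟨
    (c ∙ I) · (A · M)      ≈⟨ ·-congˡ (A · M) MMᵀ≋cI ⟨
    (M · (M ᵀ)) · (A · M)  ≈⟨ ·-assoc M (M ᵀ) (A · M) ⟩
    M · ((M ᵀ) · (A · M))  ≈⟨ ·-congʳ M (·-assoc (M ᵀ) A M) ⟨
    M · (((M ᵀ) · A) · M)  ≈⟨ ·-congʳ M MᵀAM≋cC ⟩
    M · (c ∙ C)            ≈⟨ ·-∙ʳ c M C ⟩
    c ∙ (M · C)            ∎
    where open ≋-Reasoning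

  conjugate-power : ∀ {n} (A M C : Mat R n n) c → (M ᵀ) · M ≋ c ∙ I →
    A · M ≋ M · C → ∀ k → (M ᵀ) · ((A ^ k) · M) ≋ c ∙ (C ^ k)
  conjugate-power A M C c MᵀM≋cI AM≋MC k = begin
    (M ᵀ) · ((A ^ k) · M)  ≈⟨ ·-congʳ (M ᵀ) (^-intertwine A M C AM≋MC k) ⟩
    (M ᵀ) · (M · (C ^ k))  ≈⟨ ·-assoc (M ᵀ) M (C ^ k) ⟨
    ((M ᵀ) · M) · (C ^ k)  ≈⟨ ·-congˡ (C ^ k) MᵀM≋cI ⟩
    (c ∙ I) · (C ^ k)      ≈⟨ ·-∙ˡ c I (C ^ k) ⟩
    c ∙ (I · (C ^ k))      ≈⟨ (λ i j → cong (c *_) (·-identityˡ (C ^ k) i j)) ⟩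
    c ∙ (C ^ k)            ∎
    where open ≋-Reasoning

  walk-pairing : ∀ {n} (A M C : Mat R n n) a → A ᵀ ≋ A → A · M ≋ M · C →
    (∀ i → ((M ᵀ) ⊙ e) i ≡ a) → ∀ k j →
    dot ((A ^ k) ⊙ e) (λ i → M i j) ≡ a * Σ[< n ] (λ i → (C ^ k) i j)
  walk-pairing {n} A M C a Aᵀ≋A AM≋MC Mᵀe≡a k j = begin
    dot ((A ^ k) ⊙ e) x      ≡⟨ dot-comm _ x ⟩
    dot x ((A ^ k) ⊙ e)      ≡⟨ dot-sym (A ^ k) (^-sym A Aᵀ≋A k) e x ⟩
    dot e ((A ^ k) ⊙ x)      ≡⟨ Σ-cong n (λ i → cong (one# *_) (^-intertwine A M C AM≋MC k i j)) ⟩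
    dot e (M ⊙ c)            ≡⟨ dot-adjoint M e c ⟩
    dot ((M ᵀ) ⊙ e) c        ≡⟨ Σ-cong n (λ i → cong (_* c i) (Mᵀe≡a i)) ⟩
    Σ[< n ] (λ i → a * c i)  ≡⟨ Σ-*ˡ n a c ⟩
    a * Σ[< n ] c            ∎
    where
    open ≡-Reasoning
    x c : Vect R n
    x i = M i j
    c i = (C ^ k) i j

module Transfer {R S : Set}
  {0ᴿ 1ᴿ : R} {_+ᴿ_ _*ᴿ_ : R → R → R} {0ˢ 1ˢ : S} {_+ˢ_ _*ˢ_ : S → S → S}
  (φ : R → S) (φ-0 : φ 0ᴿ ≡ 0ˢ) (φ-1 : φ 1ᴿ ≡ 1ˢ)
  (φ-+ : ∀ a b → φ (a +ᴿ b) ≡ φ a +ˢ φ b) (φ-* : ∀ a b → φ (a *ᴿ b) ≡ φ a *ˢ φ b) where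

  private
    module ᴿ = MatOps 0ᴿ 1ᴿ _+ᴿ_ _*ᴿ_
    module ˢ = MatOps 0ˢ 1ˢ _+ˢ_ _*ˢ_

  map-Σ : ∀ n {f : Fin n → R} {g : Fin n → S} → (∀ i → φ (f i) ≡ g i) →
    φ (ᴿ.Σ[< n ] f) ≡ ˢ.Σ[< n ] g
  map-Σ zero    φf≗g = φ-0
  map-Σ (suc n) φf≗g = trans (φ-+ _ _) (cong₂ _+ˢ_ (φf≗g zero) (map-Σ n (λ i → φf≗g (suc i))))

  mapMat : ∀ {m n} → Mat R m n → Mat S m n
  mapMat X i j = φ (X i j)

  map-· : ∀ {m k n} (X : Mat R m k) (Y : Mat R k n) i j →
    φ (ᴿ._·_ X Y i j) ≡ ˢ._·_ (mapMat X) (mapMat Y) i j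
  map-· {k = k} X Y i j = map-Σ k (λ l → φ-* (X i l) (Y l j))

  map-I : ∀ {n} (i j : Fin n) → φ (ᴿ.I i j) ≡ ˢ.I i j
  map-I zero    zero    = φ-1
  map-I zero    (suc j) = φ-0
  map-I (suc i) zero    = φ-0
  map-I (suc i) (suc j) = map-I i j

toℚ : ℤ → ℚ
toℚ i = i ℚ./ 1

-- toℚ i is the fraction  i / 1 , which is already in lowest terms.
↥-toℚ : ∀ i → ↥ toℚ i ≡ i
↥-toℚ i = begin
  ↥ toℚ i                      ≡⟨ ℤP.*-identityʳ _ ⟨
  ↥ toℚ i ℤ.* + 1              ≡⟨ cong (↥ toℚ i ℤ.*_) (ℤGCD.gcd-zeroʳ i) ⟨
  ↥ toℚ i ℤ.* ℤGCD.gcd i (+ 1) ≡⟨ ℚP.↥-/ i 1 ⟩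
  i                            ∎
  where open ≡-Reasoning

↧-toℚ : ∀ i → ↧ toℚ i ≡ + 1
↧-toℚ i = begin
  ↧ toℚ i                      ≡⟨ ℤP.*-identityʳ _ ⟨
  ↧ toℚ i ℤ.* + 1              ≡⟨ cong (↧ toℚ i ℤ.*_) (ℤGCD.gcd-zeroʳ i) ⟨
  ↧ toℚ i ℤ.* ℤGCD.gcd i (+ 1) ≡⟨ ℚP.↧-/ i 1 ⟩
  + 1                          ∎
  where open ≡-Reasoning

toℚ-injective : ∀ {i j} → toℚ i ≡ toℚ j → i ≡ j
toℚ-injective {i} {j} eq = trans (sym (↥-toℚ i)) (trans (cong ↥_ eq) (↥-toℚ j))

toℚ-↥ : ∀ q → IsIntegralℚ q → toℚ (↥ q) ≡ q
toℚ-↥ q ↧q≡1 = ℚP.≃⇒≡ (ℚ.*≡* (begin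
  ↥ toℚ (↥ q) ℤ.* ↧ q  ≡⟨ cong₂ ℤ._*_ (↥-toℚ (↥ q)) (cong +_ ↧q≡1) ⟩
  ↥ q ℤ.* + 1          ≡⟨ cong (↥ q ℤ.*_) (↧-toℚ (↥ q)) ⟨
  ↥ q ℤ.* ↧ toℚ (↥ q)  ∎))
  where open ≡-Reasoning

toℚᵘ-toℚ : ∀ i → ℚ.toℚᵘ (toℚ i) ℚᵘ.≃ ℚᵘ.mkℚᵘ i 0
toℚᵘ-toℚ i = ℚᵘ.*≡* (cong₂ ℤ._*_ (trans (ℚP.↥ᵘ-toℚᵘ (toℚ i)) (↥-toℚ i))
  (sym (trans (ℚP.↧ᵘ-toℚᵘ (toℚ i)) (↧-toℚ i))))

toℚ-+ : ∀ i j → toℚ (i ℤ.+ j) ≡ toℚ i ℚ.+ toℚ j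
toℚ-+ i j = ℚP.toℚᵘ-injective (begin
  ℚ.toℚᵘ (toℚ (i ℤ.+ j))                   ≈⟨ toℚᵘ-toℚ (i ℤ.+ j) ⟩
  ℚᵘ.mkℚᵘ (i ℤ.+ j) 0                      ≈⟨ ℚᵘ.*≡* (cong₂ (λ a b → (a ℤ.+ b) ℤ.* + 1) (ℤP.*-identityʳ i) (ℤP.*-identityʳ j)) ⟨
  ℚᵘ.mkℚᵘ i 0 ℚᵘ.+ ℚᵘ.mkℚᵘ j 0             ≈⟨ ℚᵘP.+-cong (toℚᵘ-toℚ i) (toℚᵘ-toℚ j) ⟨
  ℚ.toℚᵘ (toℚ i) ℚᵘ.+ ℚ.toℚᵘ (toℚ j)       ≈⟨ ℚP.toℚᵘ-homo-+ (toℚ i) (toℚ j) ⟨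
  ℚ.toℚᵘ (toℚ i ℚ.+ toℚ j)                 ∎)
  where open ℚᵘP.≃-Reasoning

toℚ-* : ∀ i j → toℚ (i ℤ.* j) ≡ toℚ i ℚ.* toℚ j
toℚ-* i j = ℚP.toℚᵘ-injective (begin
  ℚ.toℚᵘ (toℚ (i ℤ.* j))                   ≈⟨ toℚᵘ-toℚ (i ℤ.* j) ⟩
  ℚᵘ.mkℚᵘ (i ℤ.* j) 0                      ≈⟨ ℚᵘP.≃-refl ⟩
  ℚᵘ.mkℚᵘ i 0 ℚᵘ.* ℚᵘ.mkℚᵘ j 0             ≈⟨ ℚᵘP.*-cong (toℚᵘ-toℚ i) (toℚᵘ-toℚ j) ⟨
  ℚ.toℚᵘ (toℚ i) ℚᵘ.* ℚ.toℚᵘ (toℚ j)       ≈⟨ ℚP.toℚᵘ-homo-* (toℚ i) (toℚ j) ⟨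
  ℚ.toℚᵘ (toℚ i ℚ.* toℚ j)                 ∎)
  where open ℚᵘP.≃-Reasoning

module ℕA = MatrixAlgebra ℕP.+-*-isCommutativeSemiring
module ℤA = MatrixAlgebra ℤP.+-*-isCommutativeSemiring
module ℚA = MatrixAlgebra (IsCommutativeRing.isCommutativeSemiring ℚP.+-*-isCommutativeRing)

module ℕtoℤ = Transfer {0ᴿ = 0} {1ᴿ = 1} {ℕ._+_} {ℕ._*_} {+ 0} {+ 1} {ℤ._+_} {ℤ._*_}
  +_ refl refl ℤP.pos-+ ℤP.pos-*
module ℤtoℚ = Transfer {0ᴿ = + 0} {1ᴿ = + 1} {ℤ._+_} {ℤ._*_} {ℚ.0ℚ} {ℚ.1ℚ} {ℚ._+_} {ℚ._*_}
  toℚ refl refl toℚ-+ toℚ-*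

open ℤA using (_·_; _ᵀ; I; _∙_; _≋_; _^_; _⊙_; e; dot; Σ[<_]; ΣΣ; tr)

-- The square of an integer is the square of its absolute value in ℕ; this
-- turns sums of integer squares into sums of natural numbers.
square-abs : ∀ x → x ℤ.* x ≡ + (ℤ.∣ x ∣ ℕ.* ℤ.∣ x ∣)
square-abs (+ m)    = sym (ℤP.pos-* m m)
square-abs -[1+ m ] = refl

Σ-zero : ∀ n (g : Fin n → ℕ) → ℕA.Σ[< n ] g ≡ 0 → ∀ i → g i ≡ 0
Σ-zero (suc n) g Σg≡0 zero    = ℕP.m+n≡0⇒m≡0 (g zero) Σg≡0
Σ-zero (suc n) g Σg≡0 (suc i) = Σ-zero n (λ i → g (suc i)) (ℕP.m+n≡0⇒n≡0 (g zero) Σg≡0) i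

term≤Σ : ∀ n (g : Fin n → ℕ) i → g i ≤ ℕA.Σ[< n ] g
term≤Σ (suc n) g zero    = ℕP.m≤m+n (g zero) _
term≤Σ (suc n) g (suc i) = ℕP.≤-trans (term≤Σ n (λ i → g (suc i)) i) (ℕP.m≤n+m _ (g zero))

squares-vanish : ∀ m n (D : Mat ℤ m n) → ΣΣ m n (λ i j → D i j ℤ.* D i j) ≡ + 0 →
  ∀ i j → D i j ≡ + 0
squares-vanish m n D ΣΣD²≡0 i j = ℤP.∣i∣≡0⇒i≡0 (square-zero (Σ-zero n _ (Σ-zero m _ Σ≡0 i) j))
  where
  Σ≡0 : ℕA.ΣΣ m n (λ i j → ℤ.∣ D i j ∣ ℕ.* ℤ.∣ D i j ∣) ≡ 0
  Σ≡0 = ℤP.+-injective (trans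
    (ℕtoℤ.map-Σ m (λ i → ℕtoℤ.map-Σ n (λ j → sym (square-abs (D i j))))) ΣΣD²≡0)
  square-zero : ∀ {a} → a ℕ.* a ≡ 0 → a ≡ 0
  square-zero {a} a²≡0 with ℕP.m*n≡0⇒m≡0∨n≡0 a a²≡0
  ... | inj₁ a≡0 = a≡0
  ... | inj₂ a≡0 = a≡0

-- For a square integer matrix, a left inverse up to a scalar is a right
-- inverse: with  P = M Mᵀ , one has  P² = c P  and  tr P = c n , so the
-- entries of  c I − P  have square sum  c² n − 2c·cn + c·cn = 0 .
module _ {n} (M : Mat ℤ n n) (c : ℤ) (MᵀM≋cI : (M ᵀ) · M ≋ c ∙ I) where

  private
    P : Mat ℤ n n
    P = M · (M ᵀ)

    P-sym : ∀ i j → P i j ≡ P j i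
    P-sym i j = ℤA.Σ-cong n (λ l → ℤP.*-comm (M i l) (M j l))

    tr-I : tr (I {n}) ≡ + n
    tr-I = trans (ℤA.Σ-cong n ℤA.I-diag) (Σ-ones n)
      where
      Σ-ones : ∀ n → Σ[< n ] (λ _ → + 1) ≡ + n
      Σ-ones zero    = refl
      Σ-ones (suc n) = trans (cong (ℤ._+_ (+ 1)) (Σ-ones n)) (sym (ℤP.pos-+ 1 n))

    tr-P : tr P ≡ c ℤ.* + n
    tr-P = begin
      tr (M · (M ᵀ))  ≡⟨ ℤA.tr-comm M (M ᵀ) ⟩
      tr ((M ᵀ) · M)  ≡⟨ ℤA.tr-cong {n} MᵀM≋cI ⟩
      tr {n} (c ∙ I)  ≡⟨ ℤA.tr-∙ {n} c I ⟩
      c ℤ.* tr {n} I  ≡⟨ cong (c ℤ.*_) tr-I ⟩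
      c ℤ.* + n       ∎
      where open ≡-Reasoning

    P²≋cP : P · P ≋ c ∙ P
    P²≋cP = begin
      (M · (M ᵀ)) · P        ≈⟨ ℤA.·-assoc M (M ᵀ) P ⟩
      M · ((M ᵀ) · P)        ≈⟨ ℤA.·-congʳ M (ℤA.·-assoc (M ᵀ) M (M ᵀ)) ⟨
      M · (((M ᵀ) · M) · (M ᵀ))  ≈⟨ ℤA.·-congʳ M (ℤA.·-congˡ (M ᵀ) MᵀM≋cI) ⟩
      M · ((c ∙ I) · (M ᵀ))  ≈⟨ ℤA.·-congʳ M (ℤA.·-∙ˡ c I (M ᵀ)) ⟩
      M · (c ∙ (I · (M ᵀ)))  ≈⟨ ℤA.·-∙ʳ c M (I · (M ᵀ)) ⟩
      c ∙ (M · (I · (M ᵀ)))  ≈⟨ (λ i j → cong (c ℤ.*_) (ℤA.·-congʳ M (ℤA.·-identityˡ (M ᵀ)) i j)) ⟩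
      c ∙ P                  ∎
      where open ℤA.≋-Reasoning

    D : Mat ℤ n n
    D i j = c ℤ.* I i j ℤ.- P i j

    expand : ∀ c a p → (c ℤ.* a ℤ.- p) ℤ.* (c ℤ.* a ℤ.- p) ≡
      c ℤ.* (c ℤ.* (a ℤ.* a)) ℤ.+ ℤ.- (c ℤ.+ c) ℤ.* (a ℤ.* p) ℤ.+ p ℤ.* p
    expand = solve-∀

    cancels : ∀ c n → c ℤ.* (c ℤ.* n) ℤ.+ ℤ.- (c ℤ.+ c) ℤ.* (c ℤ.* n) ℤ.+ c ℤ.* (c ℤ.* n) ≡ + 0
    cancels = solve-∀

    ΣΣ-II : ΣΣ n n (λ i j → I i j ℤ.* I i j) ≡ + n
    ΣΣ-II = trans (ℤA.Σ-cong n (λ i → ℤA.Σ-select n (I i) i)) tr-I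

    -- T i j + P i j · P j i  is the square of an entry of D (as P is
    -- symmetric); the three kinds of terms are summed separately below.
    T : Fin n → Fin n → ℤ
    T i j = c ℤ.* (c ℤ.* (I i j ℤ.* I i j)) ℤ.+ ℤ.- (c ℤ.+ c) ℤ.* (I i j ℤ.* P i j)

    D-entry² : ∀ i j → D i j ℤ.* D i j ≡ T i j ℤ.+ P i j ℤ.* P j i
    D-entry² i j = trans (expand c (I i j) (P i j)) (cong (λ q → T i j ℤ.+ P i j ℤ.* q) (P-sym i j))

    ΣΣ-T₁ : ΣΣ n n (λ i j → c ℤ.* (c ℤ.* (I i j ℤ.* I i j))) ≡ c ℤ.* (c ℤ.* + n)
    ΣΣ-T₁ = begin
      ΣΣ n n (λ i j → c ℤ.* (c ℤ.* (I i j ℤ.* I i j)))  ≡⟨ ℤA.ΣΣ-*ˡ n n c _ ⟩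
      c ℤ.* ΣΣ n n (λ i j → c ℤ.* (I i j ℤ.* I i j))    ≡⟨ cong (c ℤ.*_) (ℤA.ΣΣ-*ˡ n n c _) ⟩
      c ℤ.* (c ℤ.* ΣΣ n n (λ i j → I i j ℤ.* I i j))    ≡⟨ cong (λ s → c ℤ.* (c ℤ.* s)) ΣΣ-II ⟩
      c ℤ.* (c ℤ.* + n)                                 ∎
      where open ≡-Reasoning

    ΣΣ-T₂ : ΣΣ n n (λ i j → ℤ.- (c ℤ.+ c) ℤ.* (I i j ℤ.* P i j)) ≡ ℤ.- (c ℤ.+ c) ℤ.* (c ℤ.* + n)
    ΣΣ-T₂ = trans (ℤA.ΣΣ-*ˡ n n (ℤ.- (c ℤ.+ c)) (λ i j → I i j ℤ.* P i j))
                  (cong (ℤ.- (c ℤ.+ c) ℤ.*_) (trans (ℤA.Σ-cong n (λ i → ℤA.Σ-select n (P i) i)) tr-P))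

    tr-P² : tr (P · P) ≡ c ℤ.* (c ℤ.* + n)
    tr-P² = trans (ℤA.tr-cong {n} P²≋cP) (trans (ℤA.tr-∙ {n} c P) (cong (c ℤ.*_) tr-P))

    D-squares : ΣΣ n n (λ i j → D i j ℤ.* D i j) ≡ + 0
    D-squares = begin
      ΣΣ n n (λ i j → D i j ℤ.* D i j)
        ≡⟨ ℤA.Σ-cong n (λ i → ℤA.Σ-cong n (D-entry² i)) ⟩
      ΣΣ n n (λ i j → T i j ℤ.+ P i j ℤ.* P j i)
        ≡⟨ trans (ℤA.ΣΣ-+ n n T _) (cong (ℤ._+ tr (P · P)) (ℤA.ΣΣ-+ n n _ _)) ⟩
      ΣΣ n n (λ i j → c ℤ.* (c ℤ.* (I i j ℤ.* I i j))) ℤ.+ ΣΣ n n (λ i j → ℤ.- (c ℤ.+ c) ℤ.* (I i j ℤ.* P i j))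
        ℤ.+ tr (P · P)
        ≡⟨ cong₂ ℤ._+_ (cong₂ ℤ._+_ ΣΣ-T₁ ΣΣ-T₂) tr-P² ⟩
      c ℤ.* (c ℤ.* + n) ℤ.+ ℤ.- (c ℤ.+ c) ℤ.* (c ℤ.* + n) ℤ.+ c ℤ.* (c ℤ.* + n)
        ≡⟨ cancels c (+ n) ⟩
      + 0 ∎
      where open ≡-Reasoning

  transpose-inverse : M · (M ᵀ) ≋ c ∙ I
  transpose-inverse i j =
    sym (ℤP.i-j≡0⇒i≡j (c ℤ.* I i j) (P i j) (squares-vanish n n D D-squares i j))

intertwines : ∀ {n} (A M C : Mat ℤ n n) c .{{_ : ℤ.NonZero c}} → M · (M ᵀ) ≋ c ∙ I →
  ((M ᵀ) · A) · M ≋ c ∙ C → A · M ≋ M · C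
intertwines A M C c MMᵀ≋cI MᵀAM≋cC i j =
  ℤP.*-cancelˡ-≡ c _ _ (ℤA.conjugation-intertwines A M C c MMᵀ≋cI MᵀAM≋cC i j)

parity : ℤ → ℕ
parity x = ℤ.∣ x ∣ % 2

parity-bit : ∀ x → (parity x ≡ 0) ⊎ (parity x ≡ 1)
parity-bit x with parity x | m%n<n ℤ.∣ x ∣ 2
... | 0 | _ = inj₁ refl
... | 1 | _ = inj₂ refl
... | suc (suc _) | ℕ.s≤s (ℕ.s≤s ())

parity-decomposition : ∀ x → ∃[ y ] x ≡ + parity x ℤ.+ + 2 ℤ.* y
parity-decomposition (+ a)    = + (a / 2) , natural a
  where
  natural : ∀ a → + a ≡ + (a % 2) ℤ.+ + 2 ℤ.* + (a / 2)
  natural a = begin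
    + a                                    ≡⟨ cong +_ (m≡m%n+[m/n]*n a 2) ⟩
    + (a % 2 ℕ.+ (a / 2) ℕ.* 2)            ≡⟨ ℤP.pos-+ (a % 2) _ ⟩
    + (a % 2) ℤ.+ + ((a / 2) ℕ.* 2)        ≡⟨ cong (ℤ._+_ (+ (a % 2))) (ℤP.pos-* (a / 2) 2) ⟩
    + (a % 2) ℤ.+ + (a / 2) ℤ.* + 2        ≡⟨ cong (ℤ._+_ (+ (a % 2))) (ℤP.*-comm (+ (a / 2)) (+ 2)) ⟩
    + (a % 2) ℤ.+ + 2 ℤ.* + (a / 2)        ∎
    where open ≡-Reasoning
parity-decomposition -[1+ m ] with parity-decomposition (+ suc m)
... | y , eq = ℤ.- (+ parity (+ suc m) ℤ.+ y) , trans (cong ℤ.-_ eq) (negate (+ parity (+ suc m)) y)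
  where
  negate : ∀ r y → ℤ.- (r ℤ.+ + 2 ℤ.* y) ≡ r ℤ.+ + 2 ℤ.* ℤ.- (r ℤ.+ y)
  negate = solve-∀

square-parity : ∀ x → ∃[ w ] ℤ.∣ x ∣ ℕ.* ℤ.∣ x ∣ ≡ parity x ℕ.+ 4 ℕ.* w
square-parity x = r ℕ.* h ℕ.+ h ℕ.* h , (begin
  a ℕ.* a                                   ≡⟨ cong (λ b → b ℕ.* b) (m≡m%n+[m/n]*n a 2) ⟩
  (r ℕ.+ h ℕ.* 2) ℕ.* (r ℕ.+ h ℕ.* 2)       ≡⟨ expand r h ⟩
  r ℕ.* r ℕ.+ 4 ℕ.* (r ℕ.* h ℕ.+ h ℕ.* h)   ≡⟨ cong (ℕ._+ 4 ℕ.* (r ℕ.* h ℕ.+ h ℕ.* h)) (bit² (parity-bit x)) ⟩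
  r ℕ.+ 4 ℕ.* (r ℕ.* h ℕ.+ h ℕ.* h)         ∎)
  where
  open ≡-Reasoning
  a = ℤ.∣ x ∣
  r = a % 2
  h = a / 2
  expand : ∀ r h → (r ℕ.+ h ℕ.* 2) ℕ.* (r ℕ.+ h ℕ.* 2) ≡ r ℕ.* r ℕ.+ 4 ℕ.* (r ℕ.* h ℕ.+ h ℕ.* h)
  expand = ℕSolver.solve-∀
  bit² : ∀ {b} → (b ≡ 0) ⊎ (b ≡ 1) → b ℕ.* b ≡ b
  bit² (inj₁ refl) = refl
  bit² (inj₂ refl) = refl

-- An integer vector of squared length 4 with an odd entry has exactly four
-- odd entries: its parities sum to  s  with  s + 4w = 4  and  s ≥ 1 .
four-odd-entries : ∀ n (x : Vect ℤ n) → Σ[< n ] (λ i → x i ℤ.* x i) ≡ + 4 →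
  ∀ i → parity (x i) ≡ 1 → ℕA.Σ[< n ] (λ i → parity (x i)) ≡ 4
four-odd-entries n x ∣x∣²≡4 i odd = s+4w≡4⇒s≡4 {w = ℕA.Σ[< n ] w} (subst (_≤ s) odd (term≤Σ n (λ i → parity (x i)) i)) (begin
  s ℕ.+ 4 ℕ.* ℕA.Σ[< n ] w                     ≡⟨ cong (s ℕ.+_) (ℕA.Σ-*ˡ n 4 w) ⟨
  s ℕ.+ ℕA.Σ[< n ] (λ i → 4 ℕ.* w i)           ≡⟨ ℕA.Σ-+ n (λ i → parity (x i)) _ ⟨
  ℕA.Σ[< n ] (λ i → parity (x i) ℕ.+ 4 ℕ.* w i) ≡⟨ ℕA.Σ-cong n (λ i → proj₂ (square-parity (x i))) ⟨
  ℕA.Σ[< n ] (λ i → ℤ.∣ x i ∣ ℕ.* ℤ.∣ x i ∣)    ≡⟨ ℤP.+-injective (trans (ℕtoℤ.map-Σ n (λ i → sym (square-abs (x i)))) ∣x∣²≡4) ⟩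
  4                                            ∎)
  where
  open ≡-Reasoning
  s = ℕA.Σ[< n ] (λ i → parity (x i))
  w : Fin n → ℕ
  w i = proj₁ (square-parity (x i))
  s+4w≡4⇒s≡4 : ∀ {s w} → 1 ≤ s → s ℕ.+ 4 ℕ.* w ≡ 4 → s ≡ 4
  s+4w≡4⇒s≡4 {s} {zero}  _   eq = trans (sym (trans (cong (s ℕ.+_) (ℕP.*-zeroʳ 4)) (ℕP.+-identityʳ s))) eq
  s+4w≡4⇒s≡4 {s} {suc w} 1≤s eq = ⊥-elim (ℕP.<-irrefl refl (subst (5 ≤_) eq (ℕP.+-mono-≤ 1≤s (ℕP.m≤m*n 4 (suc w)))))

parity-even : ∀ {x} → parity x ≡ 0 → ∃[ y ] x ≡ + 2 ℤ.* y
parity-even {x} p≡0 with parity-decomposition x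
... | y , eq = y , trans eq (trans (cong (λ r → + r ℤ.+ + 2 ℤ.* y) p≡0) (ℤP.+-identityˡ _))

odd-entry : ∀ {m n} (M : Mat ℤ m n) → ¬ (∀ i j → ∃[ y ] M i j ≡ + 2 ℤ.* y) →
  ∃[ i ] ∃[ j ] parity (M i j) ≡ 1
odd-entry {m} {n} M not-even with FinP.¬∀⟶∃¬ m _ (λ i → FinP.all? (λ j → parity (M i j) ℕ.≟ 0))
                                     (λ all-even → not-even (λ i j → parity-even (all-even i j)))
... | i , row-not-even with FinP.¬∀⟶∃¬ n _ (λ j → parity (M i j) ℕ.≟ 0) row-not-even
...   | j , not-zero with parity-bit (M i j)
...     | inj₁ zero-parity = ⊥-elim (not-zero zero-parity)
...     | inj₂ one-parity  = i , j , one-parity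

multiple⇒≡0 : ∀ d t {z} → z ≡ + d ℤ.* t → z ≡ + 0 [mod d ]
multiple⇒≡0 d t {z} z≡dt = ℕD.divides ℤ.∣ t ∣ (begin
  ℤ.∣ z ℤ.- + 0 ∣         ≡⟨ cong ℤ.∣_∣ (trans (ℤP.+-identityʳ z) z≡dt) ⟩
  ℤ.∣ + d ℤ.* t ∣         ≡⟨ ℤP.abs-* (+ d) t ⟩
  d ℕ.* ℤ.∣ t ∣           ≡⟨ ℕP.*-comm d ℤ.∣ t ∣ ⟩
  ℤ.∣ t ∣ ℕ.* d           ∎)
  where open ≡-Reasoning

1≢0-mod2 : ¬ ((+ 1) ≡ + 0 [mod 2 ])
1≢0-mod2 (ℕD.divides zero    ())
1≢0-mod2 (ℕD.divides (suc q) ())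

≡0-mod : ∀ d a s t → a ℤ.+ + d ℤ.* s ≡ + d ℤ.* t → a ≡ + 0 [mod d ]
≡0-mod d a s t a+ds≡dt = multiple⇒≡0 d (t ℤ.- s) (begin
  a                                   ≡⟨ shift a (+ d) s ⟩
  (a ℤ.+ + d ℤ.* s) ℤ.- + d ℤ.* s     ≡⟨ cong (ℤ._- + d ℤ.* s) a+ds≡dt ⟩
  + d ℤ.* t ℤ.- + d ℤ.* s             ≡⟨ factor (+ d) t s ⟩
  + d ℤ.* (t ℤ.- s)                   ∎)
  where
  open ≡-Reasoning
  shift : ∀ a d s → a ≡ (a ℤ.+ d ℤ.* s) ℤ.- d ℤ.* s
  shift = solve-∀
  factor : ∀ d t s → d ℤ.* t ℤ.- d ℤ.* s ≡ d ℤ.* (t ℤ.- s)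
  factor = solve-∀

linear-mod2 : ∀ {n} (g x u y : Vect ℤ n) → (∀ i → x i ≡ u i ℤ.+ + 2 ℤ.* y i) →
  ∀ t → ℤA.dot g x ≡ + 2 ℤ.* t → ℤA.dot g u ≡ + 0 [mod 2 ]
linear-mod2 {n} g x u y x≡u+2y t gx≡2t = ≡0-mod 2 (ℤA.dot g u) (ℤA.dot g y) t (begin
  ℤA.dot g u ℤ.+ + 2 ℤ.* ℤA.dot g y    ≡⟨ ℤA.dot-linearʳ g u y (+ 2) ⟨
  ℤA.dot g (λ i → u i ℤ.+ + 2 ℤ.* y i) ≡⟨ ℤA.Σ-cong n (λ i → cong (g i ℤ.*_) (x≡u+2y i)) ⟨
  ℤA.dot g x                           ≡⟨ gx≡2t ⟩
  + 2 ℤ.* t                            ∎)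
  where open ≡-Reasoning

quadratic-mod4 : ∀ {n} (N : Mat ℤ n n) → (N ᵀ) ≋ N → ∀ (x u y : Vect ℤ n) →
  (∀ i → x i ≡ u i ℤ.+ + 2 ℤ.* y i) →
  ∀ t → ℤA.dot x (N ℤA.⊙ x) ≡ + 4 ℤ.* t → ℤA.dot u (N ℤA.⊙ u) ≡ + 0 [mod 4 ]
quadratic-mod4 N Nᵀ≋N x u y x≡u+2y t xNx≡4t = ≡0-mod 4 (q u) (b ℤ.+ q y) t (begin
  q u ℤ.+ + 4 ℤ.* (b ℤ.+ q y)                       ≡⟨ regroup (q u) b (q y) ⟩
  (q u ℤ.+ + 2 ℤ.* b) ℤ.+ + 2 ℤ.* (b ℤ.+ + 2 ℤ.* q y) ≡⟨ ℤA.quadratic-expansion N Nᵀ≋N x u y (+ 2) x≡u+2y ⟨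
  q x                                               ≡⟨ xNx≡4t ⟩
  + 4 ℤ.* t                                         ∎)
  where
  open ≡-Reasoning
  q : Vect ℤ _ → ℤ
  q v = ℤA.dot v (N ℤA.⊙ v)
  b = ℤA.dot u (N ℤA.⊙ y)
  regroup : ∀ a b d → a ℤ.+ + 4 ℤ.* (b ℤ.+ d) ≡ (a ℤ.+ + 2 ℤ.* b) ℤ.+ + 2 ℤ.* (b ℤ.+ + 2 ℤ.* d)
  regroup = solve-∀

column-sums : ∀ {n} (M : Mat ℤ n n) a .{{_ : ℤ.NonZero a}} → (M ᵀ) · M ≋ (a ℤ.* a) ∙ I →
  (∀ i → (M ℤA.⊙ ℤA.e) i ≡ a) → ∀ i → ((M ᵀ) ℤA.⊙ ℤA.e) i ≡ a
column-sums {n} M a MᵀM≋a²I Me≡a i = ℤP.*-cancelˡ-≡ a _ _ (begin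
  a ℤ.* ((M ᵀ) ℤA.⊙ ℤA.e) i             ≡⟨ ℤA.·-∙ʳ a (M ᵀ) (ℤA.col ℤA.e) i zero ⟨
  ((M ᵀ) · (a ∙ ℤA.col ℤA.e)) i zero    ≡⟨ ℤA.Σ-cong n (λ j → cong (M j i ℤ.*_) (trans (ℤP.*-identityʳ a) (sym (Me≡a j)))) ⟩
  ((M ᵀ) ℤA.⊙ (M ℤA.⊙ ℤA.e)) i          ≡⟨ ℤA.⊙-· (M ᵀ) M ℤA.e i ⟨
  (((M ᵀ) · M) ℤA.⊙ ℤA.e) i             ≡⟨ ℤA.·-congˡ (ℤA.col ℤA.e) MᵀM≋a²I i zero ⟩
  (((a ℤ.* a) ∙ I) ℤA.⊙ ℤA.e) i         ≡⟨ ℤA.·-∙ˡ (a ℤ.* a) I (ℤA.col ℤA.e) i zero ⟩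
  (a ℤ.* a) ℤ.* (I ℤA.⊙ ℤA.e) i         ≡⟨ cong ((a ℤ.* a) ℤ.*_) (ℤA.·-identityˡ (ℤA.col ℤA.e) i zero) ⟩
  (a ℤ.* a) ℤ.* + 1                     ≡⟨ ℤP.*-identityʳ (a ℤ.* a) ⟩
  a ℤ.* a                               ∎)
  where open ≡-Reasoning

bit-integral : ∀ {q} → (q ≡ ℚ.0ℚ) ⊎ (q ≡ ℚ.1ℚ) → IsIntegralℚ q
bit-integral (inj₁ refl) = refl
bit-integral (inj₂ refl) = refl

-- 2 ∈ ℚ, written as the image of 2 ∈ ℤ so that toℚ-* applies to it.
two : ℚ
two = toℚ (+ 2)

halve : ∀ {p q} → two ℚ.* p ≡ two ℚ.* q → p ≡ q
halve {p} {q} 2p≡2q = begin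
  p                    ≡⟨ ℚP.*-identityˡ p ⟨
  ℚ.½ ℚ.* two ℚ.* p    ≡⟨ ℚP.*-assoc ℚ.½ two p ⟩
  ℚ.½ ℚ.* (two ℚ.* p)  ≡⟨ cong (ℚ.½ ℚ.*_) 2p≡2q ⟩
  ℚ.½ ℚ.* (two ℚ.* q)  ≡⟨ ℚP.*-assoc ℚ.½ two q ⟨
  ℚ.½ ℚ.* two ℚ.* q    ≡⟨ ℚP.*-identityˡ q ⟩
  q                    ∎
  where open ≡-Reasoning

-- Each
-- identity is checked after applying the injective map toℚ.
module Lift {n} (Q : Mat ℚ n n) (2Q-integral : IsIntegralMat (scaleMat 2 Q)) where

  M : Mat ℤ n n
  M i j = ↥ (scaleMat 2 Q i j)

  M-lifts : toℚMat M ℚA.≋ two ℚA.∙ Q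
  M-lifts i j = toℚ-↥ _ (2Q-integral i j)

  lift-orthogonal : IsOrthogonal Q → (M ᵀ) · M ≋ (+ 4) ∙ I
  lift-orthogonal QᵀQ≡I i j = toℚ-injective (begin
    toℚ (((M ᵀ) · M) i j)                        ≡⟨ ℤtoℚ.map-· (M ᵀ) M i j ⟩
    ((toℚMat M ℚA.ᵀ) ℚA.· toℚMat M) i j          ≡⟨ ℚA.·-cong (λ a b → M-lifts b a) M-lifts i j ⟩
    ((two ℚA.∙ (Q ℚA.ᵀ)) ℚA.· (two ℚA.∙ Q)) i j  ≡⟨ ℚA.·-∙∙ two two (Q ℚA.ᵀ) Q i j ⟩
    (two ℚ.* two) ℚ.* ((Q ℚA.ᵀ) ℚA.· Q) i j      ≡⟨ cong₂ ℚ._*_ (sym (toℚ-* (+ 2) (+ 2))) (QᵀQ≡I i j) ⟩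
    toℚ (+ 4) ℚ.* ℚA.I i j                       ≡⟨ cong (toℚ (+ 4) ℚ.*_) (ℤtoℚ.map-I i j) ⟨
    toℚ (+ 4) ℚ.* toℚ (I i j)                    ≡⟨ toℚ-* (+ 4) (I i j) ⟨
    toℚ (+ 4 ℤ.* I i j)                          ∎)
    where open ≡-Reasoning

  lift-row-sums : Qm._⊙_ Q Qm.e ≡ Qm.e → ∀ i → (M ⊙ e) i ≡ + 2
  lift-row-sums Qe≡e i = toℚ-injective (begin
    toℚ ((M ⊙ e) i)                             ≡⟨ ℤtoℚ.map-· M (ℤA.col e) i zero ⟩
    (toℚMat M ℚA.· ℚA.col ℚA.e) i zero          ≡⟨ ℚA.·-congˡ (ℚA.col ℚA.e) M-lifts i zero ⟩
    ((two ℚA.∙ Q) ℚA.· ℚA.col ℚA.e) i zero      ≡⟨ ℚA.·-∙ˡ two Q (ℚA.col ℚA.e) i zero ⟩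
    two ℚ.* (Q ℚA.⊙ ℚA.e) i                     ≡⟨ cong (λ v → two ℚ.* v i) Qe≡e ⟩
    two ℚ.* ℚ.1ℚ                                ≡⟨ ℚP.*-identityʳ two ⟩
    two                                         ∎)
    where open ≡-Reasoning

  conjugate : Mat ℤ n n → Mat ℚ n n
  conjugate A = ((Q ℚA.ᵀ) ℚA.· toℚMat A) ℚA.· Q

  module _ (A : Mat ℤ n n) (B-integral : IsIntegralMat (conjugate A)) where

    C : Mat ℤ n n
    C i j = ↥ (conjugate A i j)

    lift-conjugate : ((M ᵀ) · A) · M ≋ (+ 4) ∙ C
    lift-conjugate i j = toℚ-injective (begin
      toℚ ((((M ᵀ) · A) · M) i j)                          ≡⟨ ℤtoℚ.map-· ((M ᵀ) · A) M i j ⟩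
      (toℚMat ((M ᵀ) · A) ℚA.· toℚMat M) i j               ≡⟨ ℚA.·-cong (ℤtoℚ.map-· (M ᵀ) A) M-lifts i j ⟩
      (((toℚMat M ℚA.ᵀ) ℚA.· A′) ℚA.· (two ℚA.∙ Q)) i j
        ≡⟨ ℚA.·-congˡ (two ℚA.∙ Q) (ℚA.·-congˡ A′ (λ a b → M-lifts b a)) i j ⟩
      (((two ℚA.∙ (Q ℚA.ᵀ)) ℚA.· A′) ℚA.· (two ℚA.∙ Q)) i j
        ≡⟨ ℚA.·-congˡ (two ℚA.∙ Q) (ℚA.·-∙ˡ two (Q ℚA.ᵀ) A′) i j ⟩
      ((two ℚA.∙ ((Q ℚA.ᵀ) ℚA.· A′)) ℚA.· (two ℚA.∙ Q)) i j
        ≡⟨ ℚA.·-∙∙ two two ((Q ℚA.ᵀ) ℚA.· A′) Q i j ⟩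
      (two ℚ.* two) ℚ.* conjugate A i j
        ≡⟨ cong₂ ℚ._*_ (sym (toℚ-* (+ 2) (+ 2))) (sym (toℚ-↥ (conjugate A i j) (B-integral i j))) ⟩
      toℚ (+ 4) ℚ.* toℚ (C i j)                            ≡⟨ toℚ-* (+ 4) (C i j) ⟨
      toℚ (+ 4 ℤ.* C i j)                                  ∎)
      where
      open ≡-Reasoning
      A′ : Mat ℚ n n
      A′ = toℚMat A

  even-lift-integral : (∀ i j → ∃[ y ] M i j ≡ + 2 ℤ.* y) → IsIntegralMat (scaleMat 1 Q)
  even-lift-integral M-even i j = trans (cong ℚ.denominatorℕ Q≡y) (ℤP.+-injective (↧-toℚ y))
    where
    open ≡-Reasoning
    y = proj₁ (M-even i j)
    Q≡y : ℚ.1ℚ ℚ.* Q i j ≡ toℚ y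
    Q≡y = trans (ℚP.*-identityˡ (Q i j)) (halve (begin
      two ℚ.* Q i j      ≡⟨ M-lifts i j ⟨
      toℚ (M i j)        ≡⟨ cong toℚ (proj₂ (M-even i j)) ⟩
      toℚ (+ 2 ℤ.* y)    ≡⟨ toℚ-* (+ 2) y ⟩
      two ℚ.* toℚ y      ∎))

  lift-not-even : IsLevel Q 2 → ¬ (∀ i j → ∃[ y ] M i j ≡ + 2 ℤ.* y)
  lift-not-even (_ , _ , minimal) M-even with minimal 1 (ℕ.s≤s ℕ.z≤n) (even-lift-integral M-even)
  ... | ℕ.s≤s ()

Certificate : ∀ {n} → Mat ℤ n n → Set
Certificate {n} A = Σ (Vect ℤ n) λ u →
  (∀ i → (u i ≡ + 0) ⊎ (u i ≡ + 1))
  × Zm.Σ[< n ] u ≡ + 4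
  × (∀ (k : ℕ) → 1 ≤ k → k < n → Zm.dot u (Zm._⊙_ (Zm._^_ A k) u) ≡ + 0 [mod 4 ])
  × (∀ i → Zm._⊙_ (Zm._ᵀ (walkMatrix A)) u i ≡ + 0 [mod 2 ])
  × ¬ (∀ i → u i ≡ + 0 [mod 2 ])

-- The certificate is the parity vector u of a column x of M containing an
-- odd entry.
module OddColumn {n} (A M C : Mat ℤ n n) (Aᵀ≋A : (A ᵀ) ≋ A)
  (MᵀM≋4I : (M ᵀ) · M ≋ (+ 4) ∙ I) (Me≡2 : ∀ i → (M ⊙ e) i ≡ + 2)
  (MᵀAM≋4C : ((M ᵀ) · A) · M ≋ (+ 4) ∙ C)
  (i₀ j₀ : Fin n) (odd : parity (M i₀ j₀) ≡ 1) where

  -- M Mᵀ = 4I , hence M intertwines A with C.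
  AM≋MC : A · M ≋ M · C
  AM≋MC = intertwines A M C (+ 4) (transpose-inverse M (+ 4) MᵀM≋4I) MᵀAM≋4C

  x u y : Vect ℤ n
  x i = M i j₀
  u i = + parity (x i)
  y i = proj₁ (parity-decomposition (x i))

  x≡u+2y : ∀ i → x i ≡ u i ℤ.+ + 2 ℤ.* y i
  x≡u+2y i = proj₂ (parity-decomposition (x i))

  u-bits : ∀ i → (u i ≡ + 0) ⊎ (u i ≡ + 1)
  u-bits i = Data.Sum.map (cong +_) (cong +_) (parity-bit (x i))

  -- x has squared length  (MᵀM)ⱼⱼ = 4 .
  u-weight : Σ[< n ] u ≡ + 4
  u-weight = trans (sym (ℕtoℤ.map-Σ n (λ _ → refl))) (cong +_ (four-odd-entries n x xᵀx≡4 i₀ odd))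
    where
    xᵀx≡4 : Σ[< n ] (λ i → x i ℤ.* x i) ≡ + 4
    xᵀx≡4 = trans (MᵀM≋4I j₀ j₀) (cong (ℤ._*_ (+ 4)) (ℤA.I-diag j₀))

  -- xᵀ Aᵏ x = 4 (Cᵏ)ⱼⱼ .
  u-form-mod4 : ∀ k → dot u ((A ^ k) ⊙ u) ≡ + 0 [mod 4 ]
  u-form-mod4 k = quadratic-mod4 (A ^ k) (ℤA.^-sym A Aᵀ≋A k) x u y x≡u+2y _
    (ℤA.conjugate-power A M C (+ 4) MᵀM≋4I AM≋MC k j₀ j₀)

  -- Column k of W is  Aᵏ e , and  (Aᵏ e)ᵀ x = 2 eᵀ Cᵏ eⱼ  as  Mᵀ e = 2e .
  u-walk-mod2 : ∀ k → ((walkMatrix A ᵀ) ⊙ u) k ≡ + 0 [mod 2 ]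
  u-walk-mod2 k = linear-mod2 ((A ^ toℕ k) ⊙ e) x u y x≡u+2y _
    (ℤA.walk-pairing A M C (+ 2) Aᵀ≋A AM≋MC (column-sums M (+ 2) MᵀM≋4I Me≡2) (toℕ k) j₀)

  u-odd : ¬ (∀ i → u i ≡ + 0 [mod 2 ])
  u-odd u-even = 1≢0-mod2 (subst (λ r → (+ r) ≡ + 0 [mod 2 ]) odd (u-even i₀))

  certificate : Certificate A
  certificate = u , u-bits , u-weight , (λ k _ _ → u-form-mod4 k) , u-walk-mod2 , u-odd

-- Lemma 4.3.
lemma4p3 : (n : ℕ) (A : Mat ℤ n n) → IsAdjacency A
    → det n (walkMatrix A) ≢ + 0
    → (Q : Mat ℚ n n) → IsOrthogonal Q
    → Qm._⊙_ Q Qm.e ≡ Qm.e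
    → IsAdjacencyℚ (Qm._·_ (Qm._·_ (Qm._ᵀ Q) (toℚMat A)) Q)
    → IsLevel Q 2
    → Σ (Vect ℤ n) λ u →
        (∀ i → (u i ≡ + 0) ⊎ (u i ≡ + 1))
        × Zm.Σ[< n ] u ≡ + 4
        × (∀ (k : ℕ) → 1 ≤ k → k < n → Zm.dot u (Zm._⊙_ (Zm._^_ A k) u) ≡ + 0 [mod 4 ])
        × (∀ i → Zm._⊙_ (Zm._ᵀ (walkMatrix A)) u i ≡ + 0 [mod 2 ])
        × ¬ (∀ i → u i ≡ + 0 [mod 2 ])
lemma4p3 n A (_ , A-sym , _) _ Q QᵀQ≡I Qe≡e B-adjacency level@(_ , 2Q-integral , _) =
  certify (odd-entry M (lift-not-even level))
  where
  open Lift Q 2Q-integral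
  B-integral : IsIntegralMat (conjugate A)
  B-integral i j = bit-integral (proj₁ B-adjacency i j)
  certify : ∃[ i ] ∃[ j ] parity (M i j) ≡ 1 → Certificate A
  certify (i₀ , j₀ , odd) = OddColumn.certificate A M (C A B-integral) (λ i j → A-sym j i)
    (lift-orthogonal QᵀQ≡I) (lift-row-sums Qe≡e) (lift-conjugate A B-integral) i₀ j₀ odd
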